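{- Every instance of Region Choosing is an incremental problem, i.e. its objective function $f$ is monotone, sub-additive and accountable.
   Context: An instance of Region Choosing is given by $N\in\mathbb N$, pairwise disjoint finite sets $R_1,\dots,R_N$ (regions) with $|R_i|=i$, and densities $\delta(i)\ge0$; the ground set is $\mathcal U=\bigcup_{i=1}^N R_i$ and $f(S):=\max_{i\in\{1,\dots,N\}}|R_i\cap S|\cdot\delta(i)$ for $S\subseteq\mathcal U$. A function $f\colon2^{\mathcal U}\to\mathbb R_{\ge0}$ is monotone if $S\subseteq T\Rightarrow f(S)\le f(T)$, sub-additive if $f(S)+f(T)\ge f(S\cup T)$ for all $S,T$, and accountable if for every nonempty $S\subseteq\mathcal U$ there is $s\in S$ with $f(S\setminus\{s\})\ge f(S)-f(S)/|S|$.
   Formalization: The densities δ(i) and the values of the objective function f are rational rather than real. -}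

module Defs where

open import Data.Nat as ℕ using (ℕ; zero; suc)
open import Data.Fin using (Fin; zero; suc; toℕ; _≟_)
open import Data.Bool using (Bool; true; false; _∨_; if_then_else_)
open import Data.Product using (Σ; _,_; proj₁; proj₂)
open import Data.Integer using (+_)
open import Data.Rational using (ℚ; 0ℚ; _*_; _-_; _⊔_; _/_; _≤_)
open import Relation.Nullary using (does)
open import Relation.Binary.PropositionalEquality using (_≡_)

-- Region index i : Fin N stands for region R_{toℕ i + 1}, whose elements are
-- the pairs (i , j) with j : Fin (suc (toℕ i)); hence |R_{i+1}| = i + 1 and
-- regions are pairwise disjoint.
Elem : ℕ → Set
Elem N = Σ (Fin N) (λ i → Fin (suc (toℕ i)))

Subset : ℕ → Set
Subset N = Elem N → Bool

_∈_ : ∀ {N} → Elem N → Subset N → Set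
x ∈ S = S x ≡ true

_⊆_ : ∀ {N} → Subset N → Subset N → Set
S ⊆ T = ∀ x → x ∈ S → x ∈ T

_∪_ : ∀ {N} → Subset N → Subset N → Subset N
(S ∪ T) x = S x ∨ T x

remove : ∀ {N} → Subset N → Elem N → Subset N
remove S (i , j) (i' , j') with i ≟ i'
... | Relation.Nullary.yes Relation.Binary.PropositionalEquality.refl =
        if does (j ≟ j') then false else S (i , j')
... | Relation.Nullary.no _ = S (i' , j')

count : ∀ {n} → (Fin n → Bool) → ℕ
count {zero}  p = 0
count {suc n} p = (if p zero then 1 else 0) ℕ.+ count (λ k → p (suc k))

regionCount : ∀ {N} → Subset N → Fin N → ℕ
regionCount S i = count (λ j → S (i , j))

size : ∀ {N} → Subset N → ℕ
size {N} S = sumFin (regionCount S)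
  where
  sumFin : ∀ {n} → (Fin n → ℕ) → ℕ
  sumFin {zero}  g = 0
  sumFin {suc n} g = g zero ℕ.+ sumFin (λ k → g (suc k))

maxFin : ∀ {n} → (Fin n → ℚ) → ℚ
maxFin {zero}  g = 0ℚ
maxFin {suc n} g = g zero ⊔ maxFin (λ k → g (suc k))

ℕtoℚ : ℕ → ℚ
ℕtoℚ n = (+ n) / 1

-- f(S) = max_i |R_i ∩ S| · δ(i);  δ i is the density of region R_{toℕ i + 1}
objective : ∀ {N} → (Fin N → ℚ) → Subset N → ℚ
objective δ S = maxFin (λ i → ℕtoℚ (regionCount S i) * δ i)

Monotone : ∀ {N} → (Subset N → ℚ) → Set
Monotone f = ∀ S T → S ⊆ T → f S ≤ f T

SubAdditive : ∀ {N} → (Subset N → ℚ) → Set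
SubAdditive f = ∀ S T → f (S ∪ T) ≤ f S Data.Rational.+ f T

-- nonempty S is expressed as  NonZero (size S)  (i.e. |S| ≠ 0)
Accountable : ∀ {N} → (Subset N → ℚ) → Set
Accountable f = ∀ S → .{{_ : ℕ.NonZero (size S)}} →
  Σ _ λ s → s ∈ S × (f S - f S * ((+ 1) / size S) ≤ f (remove S s))
  where open import Data.Product using (_×_)

Incremental : ∀ {N} → (Subset N → ℚ) → Set
Incremental f = Monotone f × SubAdditive f × Accountable f
  where open import Data.Product using (_×_)

{-# OPTIONS --safe #-}
module Submission where

-- Each region contributes |R_i ∩ S| · δ(i), which is monotone and subadditive in S,
-- and a maximum of such functions inherits both properties. For accountability let R
-- be a region attaining the maximum. If S has an element outside R, removing it keeps
-- the contribution of R, so f does not decrease. Otherwise S ⊆ R, so f(S) = |S| · δ(R),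
-- and removing any element of S costs exactly δ(R) = f(S) / |S|.

open import Defs
open import Data.Nat using (ℕ)
open import Data.Fin using (Fin)
open import Data.Rational using (ℚ; 0ℚ; _≤_)

open import Algebra.Bundles using (CommutativeMonoid)
import Algebra.Properties.AbelianGroup as AbelianGroupProperties
import Algebra.Properties.CommutativeSemigroup as CommSemigroupProperties
open import Data.Bool.Base using (Bool; true; false; _∨_; if_then_else_)
import Data.Bool.Properties as Bool
open import Data.Fin.Base using (zero; suc)
open import Data.Fin.Properties using (any?; _≟_; suc-injective)
open import Data.Integer.Base as ℤ using (+_)
import Data.Integer.Properties as ℤ
open import Data.Nat.Base as ℕ using (NonZero; z≤n; s≤s)
import Data.Nat.Properties as ℕ
open import Data.Product.Base using (∃; _,_; proj₁)
open import Data.Rational.Base as ℚ using (1ℚ; _+_; _-_; _*_; _/_; toℚᵘ; nonNegative)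
import Data.Rational.Properties as ℚ
import Data.Rational.Unnormalised.Base as ℚᵘ
import Data.Rational.Unnormalised.Properties as ℚᵘ
open import Data.Sum.Base using (inj₁; inj₂)
open import Function.Base using (_∘_)
open import Relation.Nullary using (Dec; yes; no; does; contradiction; ¬?; map′)
open import Relation.Nullary.Decidable using (_×-dec_)
open import Relation.Binary.PropositionalEquality
  using (_≡_; _≢_; refl; sym; trans; cong; cong₂; module ≡-Reasoning)
open import Relation.Unary using (Decidable)

indicator : Bool → ℕ
indicator b = if b then 1 else 0

indicator-mono : ∀ {b c} → (b ≡ true → c ≡ true) → indicator b ℕ.≤ indicator c
indicator-mono {false} _   = z≤n
indicator-mono {true}  b⇒c rewrite b⇒c refl = ℕ.≤-refl

indicator-∨ : ∀ b c → indicator (b ∨ c) ℕ.≤ indicator b ℕ.+ indicator c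
indicator-∨ true  c     = s≤s z≤n
indicator-∨ false true  = ℕ.≤-refl
indicator-∨ false false = z≤n

count-cong : ∀ {n} {p q : Fin n → Bool} → (∀ k → p k ≡ q k) → count p ≡ count q
count-cong {ℕ.zero}  p≗q = refl
count-cong {ℕ.suc n} p≗q = cong₂ ℕ._+_ (cong indicator (p≗q zero)) (count-cong (p≗q ∘ suc))

count-false : ∀ {n} {p : Fin n → Bool} → (∀ k → p k ≡ false) → count p ≡ 0
count-false {ℕ.zero}  p≗false = refl
count-false {ℕ.suc n} p≗false =
  cong₂ ℕ._+_ (cong indicator (p≗false zero)) (count-false (p≗false ∘ suc))

count-mono : ∀ {n} {p q : Fin n → Bool} → (∀ k → p k ≡ true → q k ≡ true) →
             count p ℕ.≤ count q
count-mono {ℕ.zero}  p⇒q = z≤n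
count-mono {ℕ.suc n} p⇒q = ℕ.+-mono-≤ (indicator-mono (p⇒q zero)) (count-mono (p⇒q ∘ suc))

count-∨ : ∀ {n} (p q : Fin n → Bool) → count (λ k → p k ∨ q k) ℕ.≤ count p ℕ.+ count q
count-∨ {ℕ.zero}  p q = z≤n
count-∨ {ℕ.suc n} p q = ℕ.≤-trans
  (ℕ.+-mono-≤ (indicator-∨ (p zero) (q zero)) (count-∨ (p ∘ suc) (q ∘ suc)))
  (ℕ.≤-reflexive (interchange (indicator (p zero)) _ _ _))
  where open CommSemigroupProperties ℕ.+-commutativeSemigroup using (interchange)

count-remove : ∀ {n} (p : Fin n → Bool) {k} → p k ≡ true →
               count p ≡ ℕ.suc (count (λ j → if does (k ≟ j) then false else p j))
count-remove p {zero} pk rewrite pk = refl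
count-remove p {suc k} pk with p zero
... | true  = cong ℕ.suc (count-remove (p ∘ suc) pk)
... | false = count-remove (p ∘ suc) pk

-- `size` sums the region counts with a function local to its where-block, which takes
-- N and S as (unused) parameters and cannot be named. `sumFin` is declared as a
-- metavariable; with-abstracting the unfolding of `size` forces it to be that function.
mutual
  sumFin : ∀ {N} → Subset N → ∀ {n} → (Fin n → ℕ) → ℕ
  sumFin = _

  size-suc : ∀ {M} (S : Subset (ℕ.suc M)) →
             size S ≡ regionCount S zero ℕ.+ sumFin S (λ k → regionCount S (suc k))
  size-suc {M} S with regionCount S zero | (λ (k : Fin M) → regionCount S (suc k))
  ... | _ | _ with ℕ.suc M | S
  ... | _ | _ = refl

sumFin-zero : ∀ {N} (S : Subset N) {n} (g : Fin n → ℕ) → (∀ k → g k ≡ 0) → sumFin S g ≡ 0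
sumFin-zero S {ℕ.zero}  g g≗0 = refl
sumFin-zero S {ℕ.suc n} g g≗0 = cong₂ ℕ._+_ (g≗0 zero) (sumFin-zero S (g ∘ suc) (g≗0 ∘ suc))

sumFin-single : ∀ {N} (S : Subset N) {n} (g : Fin n → ℕ) i →
                (∀ k → k ≢ i → g k ≡ 0) → sumFin S g ≡ g i
sumFin-single S g zero    g≗0 =
  trans (cong (g zero ℕ.+_) (sumFin-zero S (g ∘ suc) (λ k → g≗0 (suc k) (λ ()))))
        (ℕ.+-identityʳ (g zero))
sumFin-single S g (suc i) g≗0 =
  cong₂ ℕ._+_ (g≗0 zero (λ ()))
              (sumFin-single S (g ∘ suc) i (λ k k≢i → g≗0 (suc k) (k≢i ∘ suc-injective)))

maxFin-upper : ∀ {n} (g : Fin n → ℚ) i → g i ≤ maxFin g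
maxFin-upper g zero    = ℚ.p≤p⊔q (g zero) (maxFin (g ∘ suc))
maxFin-upper g (suc i) =
  ℚ.≤-trans (maxFin-upper (g ∘ suc) i) (ℚ.p≤q⊔p (g zero) (maxFin (g ∘ suc)))

maxFin-least : ∀ {n} (g : Fin n → ℚ) {q} → 0ℚ ≤ q → (∀ i → g i ≤ q) → maxFin g ≤ q
maxFin-least {ℕ.zero}  g 0≤q g≤q = 0≤q
maxFin-least {ℕ.suc n} g 0≤q g≤q = ℚ.⊔-lub (g≤q zero) (maxFin-least (g ∘ suc) 0≤q (g≤q ∘ suc))

maxFin-nonNeg : ∀ {n} (g : Fin n → ℚ) → 0ℚ ≤ maxFin g
maxFin-nonNeg {ℕ.zero}  g = ℚ.≤-refl
maxFin-nonNeg {ℕ.suc n} g =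
  ℚ.≤-trans (maxFin-nonNeg (g ∘ suc)) (ℚ.p≤q⊔p (g zero) (maxFin (g ∘ suc)))

-- Nonnegativity is needed because the empty maximum is 0ℚ: maxFin g = g zero ⊔ 0ℚ when n = 1.
maxFin-attained : ∀ {n} (g : Fin n → ℚ) → (∀ i → 0ℚ ≤ g i) → Fin n → ∃ λ i → maxFin g ≡ g i
maxFin-attained {1}               g g≥0 _ = zero , ℚ.p≥q⇒p⊔q≡p (g≥0 zero)
maxFin-attained {ℕ.suc (ℕ.suc n)} g g≥0 _
  with maxFin-attained (g ∘ suc) (g≥0 ∘ suc) zero | ℚ.⊔-sel (g zero) (maxFin (g ∘ suc))
... | _           | inj₁ max≡g0   = zero , max≡g0
... | i , rest≡gi | inj₂ max≡rest = suc i , trans max≡rest rest≡gi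

ℕtoℚ-nonNeg : ∀ n → 0ℚ ≤ ℕtoℚ n
ℕtoℚ-nonNeg n = ℚ.nonNegative⁻¹ (ℕtoℚ n) {{ℚ.normalize-nonNeg n 1}}

toℚᵘ-ℕtoℚ : ∀ n → toℚᵘ (ℕtoℚ n) ℚᵘ.≃ ℚᵘ.mkℚᵘ (+ n) 0
toℚᵘ-ℕtoℚ n = ℚ.toℚᵘ-fromℚᵘ (ℚᵘ.mkℚᵘ (+ n) 0)

ℕtoℚ-+ : ∀ m n → ℕtoℚ (m ℕ.+ n) ≡ ℕtoℚ m + ℕtoℚ n
ℕtoℚ-+ m n = ℚ.toℚᵘ-injective (begin
  toℚᵘ (ℕtoℚ (m ℕ.+ n))                ≈⟨ toℚᵘ-ℕtoℚ (m ℕ.+ n) ⟩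
  ℚᵘ.mkℚᵘ (+ (m ℕ.+ n)) 0              ≈⟨ ℚᵘ.≃-reflexive (cong (λ z → ℚᵘ.mkℚᵘ z 0) numerators) ⟩
  ℚᵘ.mkℚᵘ (+ m) 0 ℚᵘ.+ ℚᵘ.mkℚᵘ (+ n) 0 ≈⟨ ℚᵘ.+-cong (toℚᵘ-ℕtoℚ m) (toℚᵘ-ℕtoℚ n) ⟨
  toℚᵘ (ℕtoℚ m) ℚᵘ.+ toℚᵘ (ℕtoℚ n)     ≈⟨ ℚ.toℚᵘ-homo-+ (ℕtoℚ m) (ℕtoℚ n) ⟨
  toℚᵘ (ℕtoℚ m + ℕtoℚ n)               ∎)
  where
  open ℚᵘ.≃-Reasoning
  numerators : + (m ℕ.+ n) ≡ + m ℤ.* + 1 ℤ.+ + n ℤ.* + 1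
  numerators = trans (ℤ.pos-+ m n) (sym (cong₂ ℤ._+_ (ℤ.*-identityʳ (+ m)) (ℤ.*-identityʳ (+ n))))

ℕtoℚ-mono-≤ : ∀ {m n} → m ℕ.≤ n → ℕtoℚ m ≤ ℕtoℚ n
ℕtoℚ-mono-≤ {m} {n} m≤n = begin
  ℕtoℚ m                     ≡⟨ ℚ.+-identityʳ (ℕtoℚ m) ⟨
  ℕtoℚ m + 0ℚ                ≤⟨ ℚ.+-monoʳ-≤ (ℕtoℚ m) (ℕtoℚ-nonNeg (n ℕ.∸ m)) ⟩
  ℕtoℚ m + ℕtoℚ (n ℕ.∸ m)    ≡⟨ ℕtoℚ-+ m (n ℕ.∸ m) ⟨
  ℕtoℚ (m ℕ.+ (n ℕ.∸ m))     ≡⟨ cong ℕtoℚ (ℕ.m+[n∸m]≡n m≤n) ⟩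
  ℕtoℚ n                     ∎
  where open ℚ.≤-Reasoning

ℕtoℚ-*-inverse : ∀ n → ℕtoℚ (ℕ.suc n) * (+ 1 / ℕ.suc n) ≡ 1ℚ
ℕtoℚ-*-inverse n = ℚ.toℚᵘ-injective (begin
  toℚᵘ (ℕtoℚ (ℕ.suc n) * (+ 1 / ℕ.suc n))
    ≈⟨ ℚ.toℚᵘ-homo-* (ℕtoℚ (ℕ.suc n)) (+ 1 / ℕ.suc n) ⟩
  toℚᵘ (ℕtoℚ (ℕ.suc n)) ℚᵘ.* toℚᵘ (+ 1 / ℕ.suc n)
    ≈⟨ ℚᵘ.*-cong (toℚᵘ-ℕtoℚ (ℕ.suc n)) (ℚ.toℚᵘ-fromℚᵘ (ℚᵘ.mkℚᵘ (+ 1) n)) ⟩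
  ℚᵘ.mkℚᵘ (+ ℕ.suc n) 0 ℚᵘ.* ℚᵘ.mkℚᵘ (+ 1) n
    ≈⟨ ℚᵘ.*-inverseʳ (ℚᵘ.mkℚᵘ (+ ℕ.suc n) 0) ⟩
  ℚᵘ.1ℚᵘ ∎)
  where open ℚᵘ.≃-Reasoning

lose-one-share : ∀ {m n} .{{_ : NonZero m}} d → m ≡ ℕ.suc n →
                 ℕtoℚ m * d - ℕtoℚ m * d * (+ 1 / m) ≡ ℕtoℚ n * d
lose-one-share {n = n} d refl = begin
  a * d - a * d * (+ 1 / ℕ.suc n) ≡⟨ cong₂ _-_ a*d≡d+n*d share≡d ⟩
  (d + ℕtoℚ n * d) - d            ≡⟨ xyx⁻¹≈y d (ℕtoℚ n * d) ⟩
  ℕtoℚ n * d                      ∎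
  where
  open ≡-Reasoning
  open AbelianGroupProperties ℚ.+-0-abelianGroup using (xyx⁻¹≈y)
  open CommSemigroupProperties (CommutativeMonoid.commutativeSemigroup ℚ.*-1-commutativeMonoid)
    using (xy∙z≈xz∙y)
  a = ℕtoℚ (ℕ.suc n)
  share≡d : a * d * (+ 1 / ℕ.suc n) ≡ d
  share≡d = trans (xy∙z≈xz∙y a d (+ 1 / ℕ.suc n))
                  (trans (cong (_* d) (ℕtoℚ-*-inverse n)) (ℚ.*-identityˡ d))
  a*d≡d+n*d : a * d ≡ d + ℕtoℚ n * d
  a*d≡d+n*d = trans (cong (_* d) (ℕtoℚ-+ 1 n))
                    (trans (ℚ.*-distribʳ-+ d 1ℚ (ℕtoℚ n)) (cong (_+ ℕtoℚ n * d) (ℚ.*-identityˡ d)))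

p-q≤p : ∀ p {q} → 0ℚ ≤ q → p - q ≤ p
p-q≤p p {q} 0≤q = begin
  p - q    ≤⟨ ℚ.+-monoʳ-≤ p (ℚ.neg-antimono-≤ 0≤q) ⟩
  p + 0ℚ   ≡⟨ ℚ.+-identityʳ p ⟩
  p        ∎
  where open ℚ.≤-Reasoning

remove-other-region : ∀ {N} (S : Subset N) {r i} k j → r ≢ i →
                      remove S (r , k) (i , j) ≡ S (i , j)
remove-other-region S {r} {i} k j r≢i with r ≟ i
... | yes r≡i = contradiction r≡i r≢i
... | no _    = refl

remove-same-region : ∀ {N} (S : Subset N) {i} k j →
                     remove S (i , k) (i , j) ≡ (if does (k ≟ j) then false else S (i , j))
remove-same-region S {i} k j with i ≟ i
... | yes refl = refl
... | no i≢i   = contradiction refl i≢i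

regionCount-remove-other : ∀ {N} (S : Subset N) {r i} k → r ≢ i →
                           regionCount (remove S (r , k)) i ≡ regionCount S i
regionCount-remove-other S k r≢i = count-cong (λ j → remove-other-region S k j r≢i)

regionCount-remove : ∀ {N} (S : Subset N) {i} k → (i , k) ∈ S →
                     regionCount S i ≡ ℕ.suc (regionCount (remove S (i , k)) i)
regionCount-remove S {i} k ik∈S =
  trans (count-remove (λ j → S (i , j)) ik∈S)
        (cong ℕ.suc (count-cong (λ j → sym (remove-same-region S k j))))

any-element? : ∀ {N} {P : Elem N → Set} → Decidable P → Dec (∃ P)
any-element? P? = map′ (λ (i , j , p) → (i , j) , p) (λ ((i , j) , p) → i , j , p)
                       (any? λ i → any? λ j → P? (i , j))

size-empty : ∀ {N} (S : Subset N) → (∀ s → S s ≡ false) → size S ≡ 0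
size-empty S S≗false = sumFin-zero S (regionCount S) (λ i → count-false (λ j → S≗false (i , j)))

size-within-region : ∀ {N} (S : Subset N) i → (∀ s → s ∈ S → proj₁ s ≡ i) →
                     size S ≡ regionCount S i
size-within-region S i S⊆Rᵢ = sumFin-single S (regionCount S) i
  (λ k k≢i → count-false (λ j → Bool.¬-not (k≢i ∘ S⊆Rᵢ (k , j))))

element-of-nonempty : ∀ {N} (S : Subset N) .{{_ : NonZero (size S)}} → ∃ (_∈ S)
element-of-nonempty S with any-element? (λ s → S s Bool.≟ true)
... | yes s∈S = s∈S
... | no  ∄s  =
  contradiction (size-empty S (λ s → Bool.¬-not (∄s ∘ (s ,_)))) (ℕ.≢-nonZero⁻¹ (size S))

module _ {N} (δ : Fin N → ℚ) (δ≥0 : ∀ i → 0ℚ ≤ δ i) where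

  private
    f : Subset N → ℚ
    f = objective δ

  weight : Subset N → Fin N → ℚ
  weight S i = ℕtoℚ (regionCount S i) * δ i

  scaled-mono : ∀ i {m n} → m ℕ.≤ n → ℕtoℚ m * δ i ≤ ℕtoℚ n * δ i
  scaled-mono i m≤n = ℚ.*-monoʳ-≤-nonNeg (δ i) {{nonNegative (δ≥0 i)}} (ℕtoℚ-mono-≤ m≤n)

  weight-nonNeg : ∀ S i → 0ℚ ≤ weight S i
  weight-nonNeg S i = ℚ.≤-trans (ℚ.≤-reflexive (sym (ℚ.*-zeroˡ (δ i)))) (scaled-mono i {n = regionCount S i} z≤n)

  objective-monotone : Monotone f
  objective-monotone S T S⊆T = maxFin-least (weight S) (maxFin-nonNeg (weight T)) λ i →
    ℚ.≤-trans (scaled-mono i (count-mono (λ j → S⊆T (i , j)))) (maxFin-upper (weight T) i)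

  objective-subAdditive : SubAdditive f
  objective-subAdditive S T = maxFin-least (weight (S ∪ T))
    (ℚ.+-mono-≤ (maxFin-nonNeg (weight S)) (maxFin-nonNeg (weight T))) λ i → begin
      weight (S ∪ T) i
        ≤⟨ scaled-mono i (count-∨ (λ j → S (i , j)) (λ j → T (i , j))) ⟩
      ℕtoℚ (regionCount S i ℕ.+ regionCount T i) * δ i
        ≡⟨ cong (_* δ i) (ℕtoℚ-+ (regionCount S i) (regionCount T i)) ⟩
      (ℕtoℚ (regionCount S i) + ℕtoℚ (regionCount T i)) * δ i
        ≡⟨ ℚ.*-distribʳ-+ (δ i) (ℕtoℚ (regionCount S i)) (ℕtoℚ (regionCount T i)) ⟩
      weight S i + weight T i
        ≤⟨ ℚ.+-mono-≤ (maxFin-upper (weight S) i) (maxFin-upper (weight T) i) ⟩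
      f S + f T ∎
    where open ℚ.≤-Reasoning

  accountable-outside-region : ∀ S i → f S ≡ weight S i → ∀ s → proj₁ s ≢ i →
    .{{_ : NonZero (size S)}} → f S - f S * (+ 1 / size S) ≤ f (remove S s)
  accountable-outside-region S i f≡w (r , k) r≢i = begin
    f S - f S * (+ 1 / size S)  ≤⟨ p-q≤p (f S) share≥0 ⟩
    f S                         ≡⟨ f≡w ⟩
    weight S i                  ≡⟨ cong (λ c → ℕtoℚ c * δ i) (regionCount-remove-other S k r≢i) ⟨
    weight (remove S (r , k)) i ≤⟨ maxFin-upper (weight (remove S (r , k))) i ⟩
    f (remove S (r , k))        ∎
    where
    open ℚ.≤-Reasoning
    share≥0 : 0ℚ ≤ f S * (+ 1 / size S)
    share≥0 = ℚ.nonNegative⁻¹ _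
      {{ℚ.nonNeg*nonNeg⇒nonNeg (f S) {{nonNegative (maxFin-nonNeg (weight S))}}
                               (+ 1 / size S) {{ℚ.normalize-nonNeg 1 (size S)}}}}

  accountable-within-region : ∀ S i → f S ≡ weight S i → (∀ s → s ∈ S → proj₁ s ≡ i) →
    ∀ s → s ∈ S → .{{_ : NonZero (size S)}} → f S - f S * (+ 1 / size S) ≤ f (remove S s)
  accountable-within-region S i f≡w S⊆Rᵢ (r , k) s∈S with S⊆Rᵢ (r , k) s∈S
  ... | refl = begin
    f S - f S * (+ 1 / size S)
      ≡⟨ cong (λ p → p - p * (+ 1 / size S)) f≡size*δ ⟩
    ℕtoℚ (size S) * δ i - ℕtoℚ (size S) * δ i * (+ 1 / size S)
      ≡⟨ lose-one-share (δ i) (trans size≡count (regionCount-remove S k s∈S)) ⟩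
    weight (remove S (i , k)) i
      ≤⟨ maxFin-upper (weight (remove S (i , k))) i ⟩
    f (remove S (i , k)) ∎
    where
    open ℚ.≤-Reasoning
    size≡count : size S ≡ regionCount S i
    size≡count = size-within-region S i S⊆Rᵢ
    f≡size*δ : f S ≡ ℕtoℚ (size S) * δ i
    f≡size*δ = trans f≡w (cong (λ c → ℕtoℚ c * δ i) (sym size≡count))

  objective-accountable : Accountable f
  objective-accountable S with element-of-nonempty S
  ... | s₀ , s₀∈S with maxFin-attained (weight S) (weight-nonNeg S) (proj₁ s₀)
  ... | i , f≡w with any-element? (λ s → S s Bool.≟ true ×-dec ¬? (proj₁ s ≟ i))
  ... | yes (s , s∈S , s∉Rᵢ) = s , s∈S , accountable-outside-region S i f≡w s s∉Rᵢ
  ... | no ∄s = s₀ , s₀∈S , accountable-within-region S i f≡w S⊆Rᵢ s₀ s₀∈S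
    where
    S⊆Rᵢ : ∀ s → s ∈ S → proj₁ s ≡ i
    S⊆Rᵢ s s∈S with proj₁ s ≟ i
    ... | yes s∈Rᵢ = s∈Rᵢ
    ... | no  s∉Rᵢ = contradiction (s , s∈S , s∉Rᵢ) ∄s

mainTheorem5 : (N : ℕ) (δ : Fin N → ℚ) → (∀ i → 0ℚ ≤ δ i) →
                 Incremental (objective δ)
mainTheorem5 N δ δ≥0 =
  objective-monotone δ δ≥0 , objective-subAdditive δ δ≥0 , objective-accountable δ δ≥0
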